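{- Let $\Gamma$ be a graph and $(\mathcal E,D)$ a pseudo-divisor on $\Gamma$. Let $e\in\mathcal E$ be a non-loop edge with end-vertices $s,t$. If $e_0\in\mathcal E$ is an edge such that there exists a pseudo-divisor $(\mathcal E\setminus\{e,e_0\},D')$ with $(\mathcal E\setminus\{e,e_0\},D')\le(\mathcal E\setminus\{e\},D-v_e+s)$ and $(\mathcal E\setminus\{e,e_0\},D')\le(\mathcal E\setminus\{e\},D-v_e+t)$, then $e$ and $e_0$ are parallel edges of $\Gamma$.
   Context: Graphs are finite, loops and multiple edges allowed. Two edges are parallel if there are two vertices each incident to both. For $\mathcal E\subset E(\Gamma)$, $\Gamma^{\mathcal E}$ is obtained by inserting one vertex $v_e$ in the interior of each $e\in\mathcal E$. A pseudo-divisor is $(\mathcal E,D)$ with $D\colon V(\Gamma^{\mathcal E})\to\mathbb Z$ and $D(v_e)=1$ for $e\in\mathcal E$. For $e\in\mathcal E$ and a vertex $s$, $D-v_e+s$ is the divisor on $\Gamma^{\mathcal E\setminus\{e\}}$ obtained by deleting $v_e$ and adding $1$ at $s$. Order: $(\mathcal E,D)\ge(\mathcal E',D')$ iff $\mathcal E'\subset\mathcal E$ and there is $\varphi\colon\mathcal E\setminus\mathcal E'\to V(\Gamma)$ with $\varphi(e)$ an end-vertex of $e$ and $D'(v)=D(v)+|\varphi^{ -1}(v)|$ for $v\in V(\Gamma)$. -}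

module Defs where

open import Data.Nat using (ℕ)
open import Data.Integer using (ℤ; +_; _+_)
open import Data.Fin using (Fin; _≟_)
open import Data.Fin.Subset using (Subset; _∈_; _∉_; _⊆_; _─_; _∩_; ⁅_⁆; _-_; ∣_∣)
open import Data.Vec using (tabulate)
open import Data.Product using (Σ; _×_; _,_; ∃; ∃-syntax; proj₁; proj₂)
open import Data.Sum using (_⊎_; inj₁; inj₂)
open import Relation.Nullary using (¬_)
open import Relation.Nullary.Decidable using (⌊_⌋)
open import Relation.Binary.PropositionalEquality using (_≡_; _≢_)

-- A finite graph (loops and multiple edges allowed):
-- vertices Fin nV, edges Fin nE, each edge has an (unordered) pair of end-vertices.
record Graph : Set where
  field
    nV   : ℕ
    nE   : ℕ
    ends : Fin nE → Fin nV × Fin nV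

module _ (Γ : Graph) where
  open Graph Γ

  Vertex : Set
  Vertex = Fin nV

  Edge : Set
  Edge = Fin nE

  IsEnd : Vertex → Edge → Set
  IsEnd v e = (v ≡ proj₁ (ends e)) ⊎ (v ≡ proj₂ (ends e))

  IsLoop : Edge → Set
  IsLoop e = proj₁ (ends e) ≡ proj₂ (ends e)

  Parallel : Edge → Edge → Set
  Parallel e e' = ∃[ u ] ∃[ w ] (u ≢ w × IsEnd u e × IsEnd w e × IsEnd u e' × IsEnd w e')

  -- vertices of Γ^ℰ : original vertices plus one vertex v_e for each e ∈ ℰ
  VertexSub : Subset nE → Set
  VertexSub ℰ = Vertex ⊎ Σ Edge (λ e → e ∈ ℰ)

  record PseudoDivisor : Set where
    constructor pd
    field
      ℰ    : Subset nE
      D    : VertexSub ℰ → ℤ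
      D-ve : ∀ e (p : e ∈ ℰ) → D (inj₂ (e , p)) ≡ + 1

  open PseudoDivisor public

  _≥ᴾ_ : PseudoDivisor → PseudoDivisor → Set
  P ≥ᴾ Q =
    (ℰ Q ⊆ ℰ P) ×
    -- φ : ℰ∖ℰ' → V(Γ), represented as a total map on edges whose values
    -- outside ℰ∖ℰ' are irrelevant
    Σ (Edge → Vertex) (λ φ → (∀ e → e ∈ (ℰ P ─ ℰ Q) → IsEnd (φ e) e)
           × (∀ v → D Q (inj₁ v)
                ≡ D P (inj₁ v) + + ∣ (ℰ P ─ ℰ Q) ∩ tabulate (λ e → ⌊ φ e ≟ v ⌋) ∣))

  _≤ᴾ_ : PseudoDivisor → PseudoDivisor → Set
  P ≤ᴾ Q = Q ≥ᴾ P

  -- D - v_e + s : divisor on Γ^(ℰ∖{e}), deleting v_e and adding 1 at s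
  moveTo : (P : PseudoDivisor) → Edge → Vertex → PseudoDivisor
  moveTo P e s = pd (ℰ P - e) D″ (λ _ _ → _≡_.refl)
    where
      D″ : VertexSub (ℰ P - e) → ℤ
      D″ (inj₁ v) = D P (inj₁ v) + + ∣ ⁅ s ⁆ ∩ ⁅ v ⁆ ∣
      D″ (inj₂ _) = + 1

{-# OPTIONS --safe #-}
-- Compare the value at s of the common lower bound Q with the two divisors it lies below. Below
-- D - v_e + s the value at s is at least D(s) + 1, while D - v_e + t has the value D(s) there; so
-- going down from D - v_e + t to Q must raise the value at s, which is only possible by sending the
-- one removed edge e₀ to s. Hence s, and symmetrically t, are end-vertices of e₀.
module Submission where

open import Defs
open import Data.Fin.Subset using (_∈_; _-_)
open import Data.Product using (Σ; _×_; proj₁; proj₂)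
open import Relation.Nullary using (¬_)
open import Relation.Binary.PropositionalEquality using (_≡_)

open import Data.Bool.Properties using (T-≡)
open import Data.Empty using (⊥-elim)
open import Data.Fin using (Fin; _≟_)
open import Data.Fin.Subset using (Subset; _∉_; _─_; _∩_; ⁅_⁆; ∣_∣; Nonempty; inside; outside)
open import Data.Fin.Subset.Properties
  using (nonempty?; Empty-unique; ∣⊥∣≡0; ∣⁅x⁆∣≡1; ∩-idem; x∈p∩q⁻; x∈⁅y⁆⇒x≡y; p─q⊆p; x∈p∧x≢y⇒x∈p-y)
open import Data.Integer using (+_; +<+; _+_; _≤_; _<_)
import Data.Integer.Properties as ℤ
open import Data.Nat using (ℕ; z<s)
open import Data.Product using (_,_; ∃)
open import Data.Sum using (inj₁; inj₂)
open import Data.Vec using (tabulate; _∷_; there)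
open import Data.Vec.Properties using ([]=⇒lookup; lookup∘tabulate)
open import Function.Bundles using (Equivalence)
open import Relation.Nullary using (yes; no; contradiction)
open import Relation.Nullary.Decidable using (⌊_⌋; toWitness)
open import Relation.Unary using (Decidable)
open import Relation.Binary.PropositionalEquality using (_≢_; refl; sym; trans; cong; subst)

x∈p─q⇒x∉q : ∀ {n} {p q : Subset n} {x : Fin n} → x ∈ p ─ q → x ∉ q
x∈p─q⇒x∉q {p = _ ∷ p} {inside  ∷ q} (there x∈p─q) (there x∈q) = x∈p─q⇒x∉q x∈p─q x∈q
x∈p─q⇒x∉q {p = _ ∷ p} {outside ∷ q} (there x∈p─q) (there x∈q) = x∈p─q⇒x∉q x∈p─q x∈q

module _ {n : ℕ} where

  x∈p─[p-y]⇒x≡y : {p : Subset n} {x y : Fin n} → x ∈ p ─ (p - y) → x ≡ y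
  x∈p─[p-y]⇒x≡y {p} {x} {y} x∈ with x ≟ y
  ... | yes x≡y = x≡y
  ... | no  x≢y = ⊥-elim (x∈p─q⇒x∉q x∈ (x∈p∧x≢y⇒x∈p-y (p─q⊆p p (p - y) x∈) x≢y))

  ∣p∣≢0⇒nonempty : (p : Subset n) → ∣ p ∣ ≢ 0 → Nonempty p
  ∣p∣≢0⇒nonempty p ∣p∣≢0 with nonempty? p
  ... | yes ne = ne
  ... | no ¬ne = contradiction (trans (cong ∣_∣ (Empty-unique ¬ne)) (∣⊥∣≡0 n)) ∣p∣≢0

  x∈tabulate⌊P?⌋⇒P : {P : Fin n → Set} (P? : Decidable P) {x : Fin n} →
    x ∈ tabulate (λ y → ⌊ P? y ⌋) → P x
  x∈tabulate⌊P?⌋⇒P P? {x} x∈ = toWitness (Equivalence.from T-≡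
    (trans (sym (lookup∘tabulate (λ y → ⌊ P? y ⌋) x)) ([]=⇒lookup x∈)))

  ∣⁅x⁆∩⁅x⁆∣≡1 : (x : Fin n) → ∣ ⁅ x ⁆ ∩ ⁅ x ⁆ ∣ ≡ 1
  ∣⁅x⁆∩⁅x⁆∣≡1 x = trans (cong ∣_∣ (∩-idem ⁅ x ⁆)) (∣⁅x⁆∣≡1 x)

  x≢y⇒∣⁅x⁆∩⁅y⁆∣≡0 : {x y : Fin n} → x ≢ y → ∣ ⁅ x ⁆ ∩ ⁅ y ⁆ ∣ ≡ 0
  x≢y⇒∣⁅x⁆∩⁅y⁆∣≡0 {x} {y} x≢y = trans (cong ∣_∣ (Empty-unique disjoint)) (∣⊥∣≡0 n)
    where
    disjoint : ¬ Nonempty (⁅ x ⁆ ∩ ⁅ y ⁆)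
    disjoint (z , z∈) with x∈p∩q⁻ ⁅ x ⁆ ⁅ y ⁆ z∈
    ... | z∈⁅x⁆ , z∈⁅y⁆ = x≢y (trans (sym (x∈⁅y⁆⇒x≡y x z∈⁅x⁆)) (x∈⁅y⁆⇒x≡y y z∈⁅y⁆))

module _ (Γ : Graph) where

  D-moveTo-target : (P : PseudoDivisor Γ) (e : Edge Γ) (s : Vertex Γ) →
    D (moveTo Γ P e s) (inj₁ s) ≡ D P (inj₁ s) + + 1
  D-moveTo-target P e s = cong (λ k → D P (inj₁ s) + + k) (∣⁅x⁆∩⁅x⁆∣≡1 s)

  D-moveTo-elsewhere : (P : PseudoDivisor Γ) (e : Edge Γ) {s v : Vertex Γ} → s ≢ v →
    D (moveTo Γ P e s) (inj₁ v) ≡ D P (inj₁ v)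
  D-moveTo-elsewhere P e {v = v} s≢v =
    trans (cong (λ k → D P (inj₁ v) + + k) (x≢y⇒∣⁅x⁆∩⁅y⁆∣≡0 s≢v)) (ℤ.+-identityʳ (D P (inj₁ v)))

  ≥ᴾ⇒D≤ : (P Q : PseudoDivisor Γ) → _≥ᴾ_ Γ P Q → ∀ v → D P (inj₁ v) ≤ D Q (inj₁ v)
  ≥ᴾ⇒D≤ P Q (_ , _ , _ , D-eq) v = subst (D P (inj₁ v) ≤_) (sym (D-eq v)) (ℤ.i≤i+j _ _)

  ≥ᴾ-raise⇒end : (P Q : PseudoDivisor Γ) → _≥ᴾ_ Γ P Q → ∀ v → D P (inj₁ v) ≢ D Q (inj₁ v) →
    ∃ λ f → f ∈ ℰ P ─ ℰ Q × IsEnd Γ v f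
  ≥ᴾ-raise⇒end P Q (_ , φ , φ-end , D-eq) v raised
    with ∣p∣≢0⇒nonempty ((ℰ P ─ ℰ Q) ∩ tabulate (λ f → ⌊ φ f ≟ v ⌋)) unchanged-if-0
    where
    unchanged-if-0 : ∣ (ℰ P ─ ℰ Q) ∩ tabulate (λ f → ⌊ φ f ≟ v ⌋) ∣ ≢ 0
    unchanged-if-0 count≡0 =
      raised (sym (trans (D-eq v) (trans (cong (λ k → D P (inj₁ v) + + k) count≡0)
                                         (ℤ.+-identityʳ (D P (inj₁ v))))))
  ... | f , f∈ with x∈p∩q⁻ (ℰ P ─ ℰ Q) _ f∈
  ... | f∈P─Q , φf≡v =
    f , f∈P─Q , subst (λ u → IsEnd Γ u f) (x∈tabulate⌊P?⌋⇒P (λ g → φ g ≟ v) φf≡v) (φ-end f f∈P─Q)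

  common-lower-bound⇒IsEnd : (P Q : PseudoDivisor Γ) (e e₀ : Edge Γ) {s t : Vertex Γ} → t ≢ s →
    ℰ Q ≡ (ℰ P - e) - e₀ →
    _≤ᴾ_ Γ Q (moveTo Γ P e s) → _≤ᴾ_ Γ Q (moveTo Γ P e t) → IsEnd Γ s e₀
  common-lower-bound⇒IsEnd P Q e e₀ {s} {t} t≢s ℰQ≡ Q≤Pₛ Q≤Pₜ
    with ≥ᴾ-raise⇒end (moveTo Γ P e t) Q Q≤Pₜ s (ℤ.<⇒≢ Pₜ<Q)
    where
    open ℤ.≤-Reasoning
    Pₜ<Q : D (moveTo Γ P e t) (inj₁ s) < D Q (inj₁ s)
    Pₜ<Q = begin-strict
      D (moveTo Γ P e t) (inj₁ s)  ≡⟨ D-moveTo-elsewhere P e t≢s ⟩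
      D P (inj₁ s)                 ≡⟨ ℤ.+-identityʳ (D P (inj₁ s)) ⟨
      D P (inj₁ s) + + 0           <⟨ ℤ.+-monoʳ-< (D P (inj₁ s)) (+<+ z<s) ⟩
      D P (inj₁ s) + + 1           ≡⟨ D-moveTo-target P e s ⟨
      D (moveTo Γ P e s) (inj₁ s)  ≤⟨ ≥ᴾ⇒D≤ (moveTo Γ P e s) Q Q≤Pₛ s ⟩
      D Q (inj₁ s)                 ∎
  ... | f , f∈ , s-end-f =
    subst (IsEnd Γ s) (x∈p─[p-y]⇒x≡y (subst (λ R → f ∈ (ℰ P - e) ─ R) ℰQ≡ f∈)) s-end-f

lemma4p7 : (Γ : Graph) (P : PseudoDivisor Γ) (e : Edge Γ) → e ∈ ℰ P → ¬ IsLoop Γ e →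
    (e₀ : Edge Γ) → e₀ ∈ ℰ P →
    Σ (PseudoDivisor Γ) (λ Q → (ℰ Q ≡ (ℰ P - e) - e₀)
      × _≤ᴾ_ Γ Q (moveTo Γ P e (proj₁ (Graph.ends Γ e)))
      × _≤ᴾ_ Γ Q (moveTo Γ P e (proj₂ (Graph.ends Γ e)))) →
    Parallel Γ e e₀
lemma4p7 Γ P e _ s≢t e₀ _ (Q , ℰQ≡ , Q≤Pₛ , Q≤Pₜ) =
  s , t , s≢t , inj₁ refl , inj₂ refl ,
  common-lower-bound⇒IsEnd Γ P Q e e₀ (λ t≡s → s≢t (sym t≡s)) ℰQ≡ Q≤Pₛ Q≤Pₜ ,
  common-lower-bound⇒IsEnd Γ P Q e e₀ s≢t ℰQ≡ Q≤Pₜ Q≤Pₛ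
  where
  s t : Vertex Γ
  s = proj₁ (Graph.ends Γ e)
  t = proj₂ (Graph.ends Γ e)
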